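{- Let $M$ be a weakly quasiminimal pregeometry structure, let $\bar b,\bar b'$ be finite tuples from $M$ with $\mathrm{tp}(\bar b)=\mathrm{tp}(\bar b')$, and let $\bar a$ be a finite tuple from $M$. Then there is a tuple $\bar a'$ in $M$ such that $\mathrm{tp}(\bar a\bar b)=\mathrm{tp}(\bar a'\bar b')$.
   Context: $L$ is a countable language and $\mathrm{tp}$ denotes quantifier-free $L$-type; for an enumerated set $H$, $\mathrm{tp}(H)$ is the type of the enumeration. An $L$-structure $M$ with a pregeometry $\mathrm{cl}$ is a weakly quasiminimal pregeometry structure if: (QM1) if $\mathrm{tp}(a,\bar b)=\mathrm{tp}(a',\bar b')$ then $a\in\mathrm{cl}(\bar b)$ iff $a'\in\mathrm{cl}(\bar b')$; (QM3) if $A\subseteq M$ is finite then $\mathrm{cl}(A)$ is countable; (QM4) if $H,H'\subseteq M$ are countable closed subsets enumerated so that $\mathrm{tp}(H)=\mathrm{tp}(H')$, and $a\in M\setminus H$, $a'\in M\setminus H'$, then $\mathrm{tp}(H,a)=\mathrm{tp}(H',a')$; (QM5) if $H,H'\subseteq M$ are countable closed subsets or empty, enumerated so that $\mathrm{tp}(H)=\mathrm{tp}(H')$, $\bar b,\bar b'$ finite tuples with $\mathrm{tp}(H,\bar b)=\mathrm{tp}(H',\bar b')$, and $a\in\mathrm{cl}(H,\bar b)$, then there is $a'\in M$ with $\mathrm{tp}(H,\bar b,a)=\mathrm{tp}(H',\bar b',a')$. -}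

module Defs where

open import Level using (0ℓ)
open import Data.Nat using (ℕ)
open import Data.Fin using (Fin)
open import Data.Vec using (Vec; []; _∷_)
open import Data.Product using (Σ; ∃; _×_; _,_)
open import Data.Sum using (_⊎_; [_,_])
open import Data.Unit using (⊤)
open import Data.Empty using (⊥)
open import Function using (const)
open import Relation.Nullary using (¬_)
open import Relation.Binary.PropositionalEquality using (_≡_)

CountableType : Set → Set
CountableType A = Σ (A → ℕ) λ f → ∀ x y → f x ≡ f y → x ≡ y

module _ {M : Set} where

  _⊆_ : (M → Set) → (M → Set) → Set
  A ⊆ B = ∀ x → A x → B x

  image : {n : ℕ} → (Fin n → M) → M → Set
  image b x = ∃ λ i → b i ≡ x

  _∪_ : (M → Set) → (M → Set) → M → Set
  (A ∪ B) x = A x ⊎ B x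

  _∪｛_｝ : (M → Set) → M → M → Set
  (A ∪｛ b ｝) x = A x ⊎ x ≡ b

  Empty : (M → Set) → Set
  Empty A = ∀ x → ¬ A x

  CountableSet : (M → Set) → Set
  CountableSet S = Σ (M → ℕ) λ f → ∀ x y → S x → S y → f x ≡ f y → x ≡ y

  Enumerates : {I : Set} → (I → M) → (M → Set) → Set
  Enumerates {I} e H =
    (∀ i j → e i ≡ e j → i ≡ j) × (∀ i → H (e i)) × (∀ x → H x → ∃ λ i → e i ≡ x)

record Pregeometry (M : Set) : Set₁ where
  field
    cl        : (M → Set) → M → Set
    extensive : ∀ A → A ⊆ cl A
    monotone  : ∀ A B → A ⊆ B → cl A ⊆ cl B
    idempotent : ∀ A → cl (cl A) ⊆ cl A
    finiteCharacter : ∀ A a → cl A a →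
      Σ ℕ λ n → Σ (Fin n → M) λ c → (∀ i → A (c i)) × cl (image c) a
    exchange  : ∀ A a b → cl (A ∪｛ b ｝) a → ¬ cl A a → cl (A ∪｛ a ｝) b

  Closed : (M → Set) → Set
  Closed A = cl A ⊆ A

record Language : Set₁ where
  field
    Fun      : Set
    Rel      : Set
    funArity : Fun → ℕ
    relArity : Rel → ℕ
    funCountable : CountableType Fun
    relCountable : CountableType Rel

module _ (L : Language) where
  open Language L

  record Structure : Set₁ where
    field
      Carrier : Set
      funI    : (f : Fun) → Vec Carrier (funArity f) → Carrier
      relI    : (r : Rel) → Vec Carrier (relArity r) → Set

  data Term (X : Set) : Set where
    var : X → Term X
    app : (f : Fun) → Vec (Term X) (funArity f) → Term X

  data QF (X : Set) : Set where
    ⊤f ⊥f : QF X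
    _≐_   : Term X → Term X → QF X
    rel   : (r : Rel) → Vec (Term X) (relArity r) → QF X
    ¬f    : QF X → QF X
    _∧f_  : QF X → QF X → QF X
    _∨f_  : QF X → QF X → QF X

  module Semantics (𝑴 : Structure) where
    open Structure 𝑴

    module _ {X : Set} (v : X → Carrier) where
      eval    : Term X → Carrier
      evalVec : {n : ℕ} → Vec (Term X) n → Vec Carrier n
      eval (var x)    = v x
      eval (app f ts) = funI f (evalVec ts)
      evalVec []       = []
      evalVec (t ∷ ts) = eval t ∷ evalVec ts

      Sat : QF X → Set
      Sat ⊤f         = ⊤
      Sat ⊥f         = ⊥
      Sat (s ≐ t)    = eval s ≡ eval t
      Sat (rel r ts) = relI r (evalVec ts)
      Sat (¬f φ)     = ¬ Sat φ
      Sat (φ ∧f ψ)   = Sat φ × Sat ψ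
      Sat (φ ∨f ψ)   = Sat φ ⊎ Sat ψ

    -- tp(v) = tp(w): equality of quantifier-free types of the
    -- X-indexed tuples v and w
    SameType : {X : Set} → (X → Carrier) → (X → Carrier) → Set
    SameType {X} v w = ∀ (φ : QF X) → (Sat v φ → Sat w φ) × (Sat w φ → Sat v φ)

  record IsWQMPS (𝑴 : Structure) (P : Pregeometry (Structure.Carrier 𝑴)) : Set₁ where
    open Structure 𝑴
    open Semantics 𝑴
    open Pregeometry P
    field
      QM1 : ∀ {n} (a a' : Carrier) (b b' : Fin n → Carrier) →
            SameType [ const a , b ] [ const {B = ⊤} a' , b' ] →
            (cl (image b) a → cl (image b') a') × (cl (image b') a' → cl (image b) a)
      QM3 : ∀ {n} (b : Fin n → Carrier) → CountableSet (cl (image b))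
      QM4 : ∀ {I : Set} → CountableType I →
            (H H' : Carrier → Set) (e e' : I → Carrier) →
            Enumerates e H → Enumerates e' H' → Closed H → Closed H' →
            SameType e e' →
            (a a' : Carrier) → ¬ H a → ¬ H' a' →
            SameType [ e , const a ] [ e' , const {B = ⊤} a' ]
      QM5 : ∀ {I : Set} → CountableType I →
            (H H' : Carrier → Set) (e e' : I → Carrier) →
            Enumerates e H → Enumerates e' H' →
            (Closed H ⊎ Empty H) → (Closed H' ⊎ Empty H') →
            SameType e e' →
            ∀ {n} (b b' : Fin n → Carrier) →
            SameType [ e , b ] [ e' , b' ] →
            (a : Carrier) → cl (H ∪ image b) a →
            ∃ λ a' → SameType [ [ e , b ] , const a ] [ [ e' , b' ] , const {B = ⊤} a' ]

module Submission where

open import Defs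
open import Level using (0ℓ)
open import Axiom.ExcludedMiddle using (ExcludedMiddle)
open import Axiom.DoubleNegationElimination using (em⇒dne)
open import Data.Nat using (ℕ; zero; suc; _<_; _≤_; _≤′_; ≤′-refl; ≤′-step; _+_; _⊔_; _≟_; s≤s; z≤n)
open import Data.Nat.Properties
  using (≤-refl; ≤-trans; <-≤-trans; ≤-total; <-cmp; <⇒≢; 1+n≰n; +-comm; n≤1+n; m≤m⊔n; m≤n⊔m;
         m<n⇒m<1+n; m≤n⇒m<n∨m≡n; ≤⇒≤′; ≤′⇒≤)
open import Data.Nat.Induction using (<-rec)
open import Data.Fin using (Fin; zero; suc; toℕ; fromℕ<; splitAt; _↑ˡ_; _↑ʳ_)
open import Data.Fin.Properties using (toℕ<n; toℕ-fromℕ<; splitAt-↑ˡ; splitAt-↑ʳ)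
open import Data.Product using (Σ; ∃; _×_; _,_; proj₁; proj₂)
open import Data.Sum using (_⊎_; inj₁; inj₂; [_,_]; [_,_]′; map₂; swap)
open import Data.Unit using (⊤; tt)
open import Data.Empty using (⊥; ⊥-elim; ⊥-elim-irr)
open import Function using (id; _∘_; const)
open import Relation.Nullary using (¬_; Dec; yes; no)
open import Relation.Binary using (tri<; tri≈; tri>)
open import Relation.Binary.PropositionalEquality using (_≡_; _≢_; refl; sym; trans; cong; cong₂; subst; subst₂)

-- By induction on the length of a it suffices to add one element a over b.
-- If a ∈ cl(b), QM5 over the empty set realises the type of a over b'. If
-- a ∉ cl(b), there is a' ∉ cl(b'): the type of b determines the dimension of
-- cl(b), since QM1 transfers a basis of b to b' and the Steinitz exchange
-- lemma bounds independent lists. QM3 makes cl(b), cl(b') countable, and a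
-- back-and-forth built from QM5 lists them by sequences u, u' with
-- tp(b u) = tp(b' u'); removing repetitions gives enumerations of the two
-- closed sets with the same type, and QM4 yields tp(b a) = tp(b' a').

infix 2 _⇔_
_⇔_ : Set → Set → Set
A ⇔ B = (A → B) × (B → A)

⇔-refl : ∀ {A} → A ⇔ A
⇔-refl = id , id

⇔-sym : ∀ {A B} → A ⇔ B → B ⇔ A
⇔-sym (f , g) = g , f

⇔-trans : ∀ {A B C} → A ⇔ B → B ⇔ C → A ⇔ C
⇔-trans (f , g) (h , k) = h ∘ f , g ∘ k

≡⇒⇔ : ∀ {A B} → A ≡ B → A ⇔ B
≡⇒⇔ refl = ⇔-refl

Lists : {M : Set} → (ℕ → M) → (M → Set) → Set
Lists u H = (∀ i → H (u i)) × (∀ x → H x → ∃ λ i → u i ≡ x)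

-- Below k: the variables of A ⊎ ℕ that are parameters or among the first k
-- sequence positions.
Below : {A : Set} → ℕ → A ⊎ ℕ → Set
Below k (inj₁ _) = ⊤
Below k (inj₂ i) = i < k

Below-mono : ∀ {A : Set} {k k'} → k ≤ k' → Below {A} k ⊆ Below k'
Below-mono k≤k' (inj₁ _) _   = tt
Below-mono k≤k' (inj₂ i) i<k = <-≤-trans i<k k≤k'

_[_≔_] : {A : Set} → (ℕ → A) → ℕ → A → ℕ → A
(f [ k ≔ x ]) i with i ≟ k
... | yes _ = x
... | no  _ = f i

module _ {A : Set} (f : ℕ → A) (k : ℕ) (x : A) where

  update-same : (f [ k ≔ x ]) k ≡ x
  update-same with k ≟ k
  ... | yes _   = refl
  ... | no k≢k = ⊥-elim (k≢k refl)

  update-other : ∀ {i} → i ≢ k → (f [ k ≔ x ]) i ≡ f i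
  update-other {i} i≢k with i ≟ k
  ... | yes i≡k = ⊥-elim (i≢k i≡k)
  ... | no  _   = refl

  update-within : ∀ {H : A → Set} → (∀ i → i < k → H (f i)) → H x →
                  ∀ i → i < suc k → H ((f [ k ≔ x ]) i)
  update-within {H} f∈H x∈H i (s≤s i≤k) with m≤n⇒m<n∨m≡n i≤k
  ... | inj₁ i<k  = subst H (sym (update-other (<⇒≢ i<k))) (f∈H i i<k)
  ... | inj₂ refl = subst H (sym update-same) x∈H

  update-below : ∀ {B : Set} (g : B → A) z → Below k z → [ g , f [ k ≔ x ] ]′ z ≡ [ g , f ]′ z
  update-below g (inj₁ _) _   = refl
  update-below g (inj₂ i) i<k = update-other (<⇒≢ i<k)

update-twice-below : ∀ {A : Set} (f : ℕ → A) {k i} x y → i < k → ((f [ k ≔ x ]) [ suc k ≔ y ]) i ≡ f i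
update-twice-below f {k} x y i<k =
  trans (update-other (f [ k ≔ x ]) (suc k) y (<⇒≢ (m<n⇒m<1+n i<k))) (update-other f k x (<⇒≢ i<k))

module Syntax (L : Language) (𝑴 : Structure L) where
  open import Data.Vec using (Vec; []; _∷_)

  open Structure 𝑴 renaming (Carrier to M)
  open Semantics L 𝑴

  renameTerm  : {X Y : Set} → (X → Y) → Term L X → Term L Y
  renameTerms : {X Y : Set} {n : ℕ} → (X → Y) → Vec (Term L X) n → Vec (Term L Y) n
  renameTerm g (var x)    = var (g x)
  renameTerm g (app f ts) = app f (renameTerms g ts)
  renameTerms g []       = []
  renameTerms g (t ∷ ts) = renameTerm g t ∷ renameTerms g ts

  rename : {X Y : Set} → (X → Y) → QF L X → QF L Y
  rename g ⊤f         = ⊤f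
  rename g ⊥f         = ⊥f
  rename g (s ≐ t)    = renameTerm g s ≐ renameTerm g t
  rename g (rel r ts) = rel r (renameTerms g ts)
  rename g (¬f φ)     = ¬f (rename g φ)
  rename g (φ ∧f ψ)   = rename g φ ∧f rename g ψ
  rename g (φ ∨f ψ)   = rename g φ ∨f rename g ψ

  module _ {X Y : Set} (g : Y → X) {v : X → M} {u : Y → M}
           (v∘g≗u : ∀ y → v (g y) ≡ u y) where

    eval-rename  : ∀ t → eval v (renameTerm g t) ≡ eval u t
    evals-rename : ∀ {n} (ts : Vec (Term L Y) n) → evalVec v (renameTerms g ts) ≡ evalVec u ts
    eval-rename (var y)    = v∘g≗u y
    eval-rename (app f ts) = cong (funI f) (evals-rename ts)
    evals-rename []       = refl
    evals-rename (t ∷ ts) = cong₂ _∷_ (eval-rename t) (evals-rename ts)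

    Sat-rename : ∀ φ → Sat v (rename g φ) ⇔ Sat u φ
    Sat-rename ⊤f         = ⇔-refl
    Sat-rename ⊥f         = ⇔-refl
    Sat-rename (s ≐ t)    = ≡⇒⇔ (cong₂ _≡_ (eval-rename s) (eval-rename t))
    Sat-rename (rel r ts) = ≡⇒⇔ (cong (relI r) (evals-rename ts))
    Sat-rename (¬f φ)     = let (to , from) = Sat-rename φ in (_∘ from) , (_∘ to)
    Sat-rename (φ ∧f ψ)   = let (to , from) = Sat-rename φ ; (to' , from') = Sat-rename ψ in
      (λ { (p , q) → to p , to' q }) , (λ { (p , q) → from p , from' q })
    Sat-rename (φ ∨f ψ)   = let (to , from) = Sat-rename φ ; (to' , from') = Sat-rename ψ in
      [ inj₁ ∘ to , inj₂ ∘ to' ] , [ inj₁ ∘ from , inj₂ ∘ from' ]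

  SupportedTerm  : {X : Set} → (X → Set) → Term L X → Set
  SupportedTerms : {X : Set} {n : ℕ} → (X → Set) → Vec (Term L X) n → Set
  SupportedTerm S (var x)    = S x
  SupportedTerm S (app f ts) = SupportedTerms S ts
  SupportedTerms S []       = ⊤
  SupportedTerms S (t ∷ ts) = SupportedTerm S t × SupportedTerms S ts

  Supported : {X : Set} → (X → Set) → QF L X → Set
  Supported S ⊤f         = ⊤
  Supported S ⊥f         = ⊤
  Supported S (s ≐ t)    = SupportedTerm S s × SupportedTerm S t
  Supported S (rel r ts) = SupportedTerms S ts
  Supported S (¬f φ)     = Supported S φ
  Supported S (φ ∧f ψ)   = Supported S φ × Supported S ψ
  Supported S (φ ∨f ψ)   = Supported S φ × Supported S ψ

  module _ {X : Set} {S T : X → Set} (S⊆T : S ⊆ T) where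

    supportedTerm-mono  : ∀ t → SupportedTerm S t → SupportedTerm T t
    supportedTerms-mono : ∀ {n} (ts : Vec (Term L X) n) → SupportedTerms S ts → SupportedTerms T ts
    supportedTerm-mono (var x)    p = S⊆T x p
    supportedTerm-mono (app f ts) p = supportedTerms-mono ts p
    supportedTerms-mono []       _       = tt
    supportedTerms-mono (t ∷ ts) (p , q) = supportedTerm-mono t p , supportedTerms-mono ts q

    supported-mono : ∀ φ → Supported S φ → Supported T φ
    supported-mono ⊤f         _       = tt
    supported-mono ⊥f         _       = tt
    supported-mono (s ≐ t)    (p , q) = supportedTerm-mono s p , supportedTerm-mono t q
    supported-mono (rel r ts) p       = supportedTerms-mono ts p
    supported-mono (¬f φ)     p       = supported-mono φ p
    supported-mono (φ ∧f ψ)   (p , q) = supported-mono φ p , supported-mono ψ q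
    supported-mono (φ ∨f ψ)   (p , q) = supported-mono φ p , supported-mono ψ q

  module _ {X Y : Set} {S : X → Set} (g : Y → X) (g∈S : ∀ y → S (g y)) where

    renameTerm-supported  : ∀ t → SupportedTerm S (renameTerm g t)
    renameTerms-supported : ∀ {n} (ts : Vec (Term L Y) n) → SupportedTerms S (renameTerms g ts)
    renameTerm-supported (var y)    = g∈S y
    renameTerm-supported (app f ts) = renameTerms-supported ts
    renameTerms-supported []       = tt
    renameTerms-supported (t ∷ ts) = renameTerm-supported t , renameTerms-supported ts

    rename-supported : ∀ φ → Supported S (rename g φ)
    rename-supported ⊤f         = tt
    rename-supported ⊥f         = tt
    rename-supported (s ≐ t)    = renameTerm-supported s , renameTerm-supported t
    rename-supported (rel r ts) = renameTerms-supported ts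
    rename-supported (¬f φ)     = rename-supported φ
    rename-supported (φ ∧f ψ)   = rename-supported φ , rename-supported ψ
    rename-supported (φ ∨f ψ)   = rename-supported φ , rename-supported ψ

  Range : {X Y : Set} → (Y → X) → X → Set
  Range g x = ∃ λ y → g y ≡ x

  module _ {X Y : Set} (g : Y → X) where

    unrenameTerm : ∀ t → SupportedTerm (Range g) t → ∃ λ t' → renameTerm g t' ≡ t
    unrenameTerms : ∀ {n} (ts : Vec (Term L X) n) → SupportedTerms (Range g) ts →
                    ∃ λ ts' → renameTerms g ts' ≡ ts
    unrenameTerm (var x) (y , refl) = var y , refl
    unrenameTerm (app f ts) p = let (ts' , eq) = unrenameTerms ts p in app f ts' , cong (app f) eq
    unrenameTerms [] _ = [] , refl
    unrenameTerms (t ∷ ts) (p , q) =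
      let (t' , eq) = unrenameTerm t p ; (ts' , eq') = unrenameTerms ts q in
      t' ∷ ts' , cong₂ _∷_ eq eq'

    unrename : ∀ φ → Supported (Range g) φ → ∃ λ φ' → rename g φ' ≡ φ
    unrename ⊤f _ = ⊤f , refl
    unrename ⊥f _ = ⊥f , refl
    unrename (s ≐ t) (p , q) =
      let (s' , eq) = unrenameTerm s p ; (t' , eq') = unrenameTerm t q in s' ≐ t' , cong₂ _≐_ eq eq'
    unrename (rel r ts) p = let (ts' , eq) = unrenameTerms ts p in rel r ts' , cong (rel r) eq
    unrename (¬f φ) p = let (φ' , eq) = unrename φ p in ¬f φ' , cong ¬f eq
    unrename (φ ∧f ψ) (p , q) =
      let (φ' , eq) = unrename φ p ; (ψ' , eq') = unrename ψ q in φ' ∧f ψ' , cong₂ _∧f_ eq eq'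
    unrename (φ ∨f ψ) (p , q) =
      let (φ' , eq) = unrename φ p ; (ψ' , eq') = unrename ψ q in φ' ∨f ψ' , cong₂ _∨f_ eq eq'

  Sat-local : ∀ {X} (v w : X → M) φ → Supported (λ x → v x ≡ w x) φ → Sat v φ ⇔ Sat w φ
  Sat-local {X} v w φ agree with unrename proj₁ φ (supported-mono (λ x v≡w → (x , v≡w) , refl) φ agree)
  ... | φ' , refl = ⇔-trans (Sat-rename proj₁ (λ _ → refl) φ')
                            (⇔-sym (Sat-rename {Y = Σ X (λ x → v x ≡ w x)} proj₁ (sym ∘ proj₂) φ'))

  AgreeOn : {X : Set} → (X → Set) → (X → M) → (X → M) → Set
  AgreeOn S v w = ∀ φ → Supported S φ → Sat v φ ⇔ Sat w φ

  AgreeOn-sym : ∀ {X} {S : X → Set} {v w} → AgreeOn S v w → AgreeOn S w v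
  AgreeOn-sym agree φ s = ⇔-sym (agree φ s)

  agree-restrict : ∀ {X Y} {S : X → Set} {v w : X → M} → AgreeOn S v w →
                   (g : Y → X) → (∀ y → S (g y)) → {v' w' : Y → M} →
                   (∀ y → v (g y) ≡ v' y) → (∀ y → w (g y) ≡ w' y) → SameType v' w'
  agree-restrict agree g g∈S v∘g≗v' w∘g≗w' φ =
    ⇔-trans (⇔-sym (Sat-rename g v∘g≗v' φ))
            (⇔-trans (agree (rename g φ) (rename-supported g g∈S φ)) (Sat-rename g w∘g≗w' φ))

  sameType-restrict : ∀ {X Y} {v w : X → M} → SameType v w → (g : Y → X) → {v' w' : Y → M} →
                      (∀ y → v (g y) ≡ v' y) → (∀ y → w (g y) ≡ w' y) → SameType v' w'
  sameType-restrict st g = agree-restrict {S = λ _ → ⊤} (λ φ _ → st φ) g (λ _ → tt)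

  agree-extend : ∀ {X Y} {v' w' : Y → M} → SameType v' w' → (g : Y → X) → {v w : X → M} →
                 (∀ y → v (g y) ≡ v' y) → (∀ y → w (g y) ≡ w' y) →
                 {S : X → Set} → S ⊆ Range g → AgreeOn S v w
  agree-extend st g v∘g≗v' w∘g≗w' S⊆Range φ s
    with unrename g φ (supported-mono S⊆Range φ s)
  ... | φ' , refl = ⇔-trans (Sat-rename g v∘g≗v' φ') (⇔-trans (st φ') (⇔-sym (Sat-rename g w∘g≗w' φ')))

  sameType-≡ : ∀ {X} {v w : X → M} → SameType v w → ∀ x y → (v x ≡ v y) ⇔ (w x ≡ w y)
  sameType-≡ st x y = st (var x ≐ var y)

  module _ {A : Set} where

    private
      common-bound : {F G : (A ⊎ ℕ → Set) → Set} →
                     (∀ {S T} → S ⊆ T → F S → F T) → (∀ {S T} → S ⊆ T → G S → G T) →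
                     ∃ (λ N → F (Below N)) → ∃ (λ N → G (Below N)) →
                     ∃ λ N → F (Below N) × G (Below N)
      common-bound monoF monoG (N₁ , p) (N₂ , q) =
        N₁ ⊔ N₂ , monoF (Below-mono (m≤m⊔n N₁ N₂)) p , monoG (Below-mono (m≤n⊔m N₁ N₂)) q

    finite-supportTerm  : ∀ t → ∃ λ N → SupportedTerm (Below N) t
    finite-supportTerms : ∀ {n} (ts : Vec (Term L (A ⊎ ℕ)) n) → ∃ λ N → SupportedTerms (Below N) ts
    finite-supportTerm (var (inj₁ _)) = 0 , tt
    finite-supportTerm (var (inj₂ i)) = suc i , ≤-refl
    finite-supportTerm (app f ts)     = finite-supportTerms ts
    finite-supportTerms []       = 0 , tt
    finite-supportTerms (t ∷ ts) =
      common-bound (λ S⊆T → supportedTerm-mono S⊆T t) (λ S⊆T → supportedTerms-mono S⊆T ts)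
                   (finite-supportTerm t) (finite-supportTerms ts)

    finite-support : ∀ φ → ∃ λ N → Supported (Below N) φ
    finite-support ⊤f         = 0 , tt
    finite-support ⊥f         = 0 , tt
    finite-support (s ≐ t)    =
      common-bound (λ S⊆T → supportedTerm-mono S⊆T s) (λ S⊆T → supportedTerm-mono S⊆T t)
                   (finite-supportTerm s) (finite-supportTerm t)
    finite-support (rel r ts) = finite-supportTerms ts
    finite-support (¬f φ)     = finite-support φ
    finite-support (φ ∧f ψ)   =
      common-bound (λ S⊆T → supported-mono S⊆T φ) (λ S⊆T → supported-mono S⊆T ψ)
                   (finite-support φ) (finite-support ψ)
    finite-support (φ ∨f ψ)   =
      common-bound (λ S⊆T → supported-mono S⊆T φ) (λ S⊆T → supported-mono S⊆T ψ)
                   (finite-support φ) (finite-support ψ)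

module PregeometryFacts (em : ExcludedMiddle 0ℓ) {M : Set} (P : Pregeometry M) where
  open import Data.List using (List; []; _∷_; _∷ʳ_; length; map)
  open import Data.List.Properties using (map-++)
  open import Data.List.Membership.Propositional using (_∈_)
  open import Data.List.Membership.Propositional.Properties using (∈-++⁺ˡ; ∈-++⁺ʳ)
  open import Data.List.Relation.Unary.Any using (here; there)

  open Pregeometry P

  cl-mono : ∀ {B C} → B ⊆ C → cl B ⊆ cl C
  cl-mono {B} {C} = monotone B C

  cl-least : ∀ {B C} → B ⊆ cl C → cl B ⊆ cl C
  cl-least {B} {C} B⊆clC x x∈clB = idempotent C x (cl-mono B⊆clC x x∈clB)

  Independent : (M → Set) → List M → Set
  Independent A []       = ⊤
  Independent A (x ∷ xs) = ¬ cl A x × Independent (A ∪｛ x ｝) xs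

  insert⊆cons : ∀ {A : M → Set} {y : M} {ys : List M} →
                ((A ∪｛ y ｝) ∪ (_∈ ys)) ⊆ (A ∪ (_∈ y ∷ ys))
  insert⊆cons _ (inj₁ (inj₁ a))    = inj₁ a
  insert⊆cons _ (inj₁ (inj₂ refl)) = inj₂ (here refl)
  insert⊆cons _ (inj₂ z∈)          = inj₂ (there z∈)

  cons⊆insert : ∀ {A : M → Set} {y : M} {ys : List M} →
                (A ∪ (_∈ y ∷ ys)) ⊆ ((A ∪｛ y ｝) ∪ (_∈ ys))
  cons⊆insert _ (inj₁ a)          = inj₁ (inj₁ a)
  cons⊆insert _ (inj₂ (here eq))  = inj₁ (inj₂ eq)
  cons⊆insert _ (inj₂ (there z∈)) = inj₂ z∈

  independent-snoc : ∀ A xs {x} → Independent A xs → ¬ cl (A ∪ (_∈ xs)) x →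
                     Independent A (xs ∷ʳ x)
  independent-snoc A []       _          x∉ = (λ x∈ → x∉ (cl-mono (λ _ → inj₁) _ x∈)) , tt
  independent-snoc A (y ∷ xs) (y∉ , ind) x∉ =
    y∉ , independent-snoc (A ∪｛ y ｝) xs ind (λ x∈ → x∉ (cl-mono insert⊆cons _ x∈))

  exchange-into : ∀ A x ys → cl (A ∪ (_∈ ys)) x → ¬ cl A x →
                  ∃ λ zs → length ys ≡ suc (length zs) ×
                           (_∈ ys) ⊆ cl ((A ∪｛ x ｝) ∪ (_∈ zs))
  exchange-into A x [] x∈ x∉ = ⊥-elim (x∉ (cl-mono (λ { _ (inj₁ a) → a ; _ (inj₂ ()) }) x x∈))
  exchange-into A x (y ∷ ys) x∈ x∉ with em {cl (A ∪｛ y ｝) x}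
  ... | yes x∈A+y = ys , refl , λ
    { _ (here refl) → cl-mono (λ _ → inj₁) y (exchange A x y x∈A+y x∉)
    ; z (there z∈)  → extensive _ z (inj₂ z∈) }
  ... | no x∉A+y with exchange-into (A ∪｛ y ｝) x ys (cl-mono cons⊆insert x x∈) x∉A+y
  ...   | zs , len , span = y ∷ zs , cong suc len , λ
    { _ (here refl) → extensive _ y (inj₂ (here refl))
    ; z (there z∈)  → cl-mono exchanged z (span z z∈) }
    where
    exchanged : (((A ∪｛ y ｝) ∪｛ x ｝) ∪ (_∈ zs)) ⊆ ((A ∪｛ x ｝) ∪ (_∈ y ∷ zs))
    exchanged _ (inj₁ (inj₁ (inj₁ a)))    = inj₁ (inj₁ a)
    exchanged _ (inj₁ (inj₁ (inj₂ refl))) = inj₂ (here refl)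
    exchanged _ (inj₁ (inj₂ eq))          = inj₁ (inj₂ eq)
    exchanged _ (inj₂ z∈)                 = inj₂ (there z∈)

  steinitz : ∀ A xs ys → Independent A xs → (_∈ xs) ⊆ cl (A ∪ (_∈ ys)) → length xs ≤ length ys
  steinitz A []       ys _          _    = z≤n
  steinitz A (x ∷ xs) ys (x∉ , ind) span
    with exchange-into A x ys (span x (here refl)) x∉
  ... | zs , len , ys⊆ = subst (suc (length xs) ≤_) (sym len)
    (s≤s (steinitz (A ∪｛ x ｝) xs zs ind λ z z∈ → cl-least base⊆ z (span z (there z∈))))
    where
    base⊆ : (A ∪ (_∈ ys)) ⊆ cl ((A ∪｛ x ｝) ∪ (_∈ zs))
    base⊆ z (inj₁ a)  = extensive _ z (inj₁ (inj₁ a))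
    base⊆ z (inj₂ z∈) = ys⊆ z z∈

  basis : ∀ {I : Set} A (b : I → M) (js : List I) →
          ∃ λ l → Independent A (map b l) × (∀ j → j ∈ js → cl (A ∪ (_∈ map b l)) (b j))
  basis A b [] = [] , tt , λ _ ()
  basis A b (j ∷ js) with basis A b js
  ... | l , ind , span with em {cl (A ∪ (_∈ map b l)) (b j)}
  ...   | yes bj∈ = l , ind , λ { _ (here refl) → bj∈ ; k (there k∈) → span k k∈ }
  ...   | no  bj∉ = l ∷ʳ j , ind' , λ
    { _ (here refl) → extensive _ (b j) (inj₂ (subst (b j ∈_) map-snoc (∈-++⁺ʳ (map b l) (here refl))))
    ; k (there k∈)  → cl-mono grow (b k) (span k k∈) }
    where
    map-snoc : map b l ∷ʳ b j ≡ map b (l ∷ʳ j)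
    map-snoc = sym (map-++ b l (j ∷ []))
    ind' : Independent A (map b (l ∷ʳ j))
    ind' = subst (Independent A) map-snoc (independent-snoc A (map b l) ind bj∉)
    grow : (A ∪ (_∈ map b l)) ⊆ (A ∪ (_∈ map b (l ∷ʳ j)))
    grow _ (inj₁ a)  = inj₁ a
    grow _ (inj₂ z∈) = inj₂ (subst (_ ∈_) map-snoc (∈-++⁺ˡ z∈))

module Sequences (em : ExcludedMiddle 0ℓ) {M : Set} where

  -- A countable set with a point is listed by some sequence: send j to the
  -- element with code j, or to the chosen point if there is none.
  countable-listed : ∀ {H : M → Set} → CountableSet H → ∀ {d} → H d → ∃ λ u → Lists u H
  countable-listed {H} (code , code-inj) {d} d∈H = u , pick∈H ∘ decide , onto
    where
    Coded : ℕ → Set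
    Coded j = ∃ λ x → H x × code x ≡ j
    decide : ∀ j → Dec (Coded j)
    decide j = em
    pick : ∀ {j} → Dec (Coded j) → M
    pick (yes (x , _)) = x
    pick (no _)        = d
    u : ℕ → M
    u j = pick (decide j)
    pick∈H : ∀ {j} (coded? : Dec (Coded j)) → H (pick coded?)
    pick∈H (yes (_ , x∈H , _)) = x∈H
    pick∈H (no _)              = d∈H
    pick-code : ∀ x → H x → (coded? : Dec (Coded (code x))) → pick coded? ≡ x
    pick-code x x∈H (yes (y , y∈H , same)) = code-inj y x y∈H x∈H same
    pick-code x x∈H (no uncoded)           = ⊥-elim (uncoded (x , x∈H , refl))
    onto : ∀ x → H x → ∃ λ i → u i ≡ x
    onto x x∈H = code x , pick-code x x∈H (decide (code x))

  -- Removing repetitions from a sequence u: the positions of first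
  -- occurrences index every value exactly once.
  module Deduplicate (u : ℕ → M) where

    -- a position i at which u i occurs for the first time (the witness is
    -- irrelevant, so positions are determined by their index)
    record Position : Set where
      constructor position
      field
        index       : ℕ
        .first-time : ∀ j → j < index → u j ≢ u index
    open Position public

    index-injective : ∀ p q → index p ≡ index q → p ≡ q
    index-injective (position i _) (position .i _) refl = refl

    countable : CountableType Position
    countable = index , index-injective

    first-occurrence : ∀ i → ∃ λ (p : Position) → u (index p) ≡ u i
    first-occurrence = <-rec _ λ i earlier → case-earlier i earlier em
      where
      case-earlier : ∀ i → (∀ {j} → j < i → ∃ λ (p : Position) → u (index p) ≡ u j) →
                     Dec (∃ λ j → j < i × u j ≡ u i) → ∃ λ (p : Position) → u (index p) ≡ u i
      case-earlier i earlier (yes (j , j<i , same)) =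
        let (p , eq) = earlier j<i in p , trans eq same
      case-earlier i earlier (no none) = position i (λ j j<i same → none (j , j<i , same)) , refl

    value-injective : ∀ p q → u (index p) ≡ u (index q) → p ≡ q
    value-injective p@(position i first-i) q@(position j first-j) same with <-cmp i j
    ... | tri< i<j _ _ = ⊥-elim-irr (first-j i i<j same)
    ... | tri≈ _ i≡j _ = index-injective p q i≡j
    ... | tri> _ _ j<i = ⊥-elim-irr (first-i j j<i (sym same))

    enumerates : ∀ (u' : ℕ → M) → (∀ i j → (u i ≡ u j) ⇔ (u' i ≡ u' j)) →
                 ∀ {H} → Lists u' H → Enumerates (u' ∘ index) H
    enumerates u' same-pattern (into , onto) =
      (λ p q same → value-injective p q (proj₂ (same-pattern (index p) (index q)) same)) ,
      (λ p → into (index p)) ,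
      λ x x∈H → let (i , u'i≡x) = onto x x∈H ; (p , same) = first-occurrence i in
                p , trans (proj₁ (same-pattern (index p) i) same) u'i≡x

module Stabilizing {A : Set} (size : ℕ → ℕ) (size-mono : ∀ {j j'} → j ≤ j' → size j ≤ size j')
                   (size-grows : ∀ i → i < size (suc i))
                   (F : ℕ → ℕ → A) (stable : ∀ j {i} → i < size j → F (suc j) i ≡ F j i) where

  stable* : ∀ {j j' i} → j ≤′ j' → i < size j → F j' i ≡ F j i
  stable* ≤′-refl        _   = refl
  stable* (≤′-step j≤j') i<s =
    trans (stable _ (<-≤-trans i<s (size-mono (≤′⇒≤ j≤j')))) (stable* j≤j' i<s)

  limit : ℕ → A
  limit i = F (suc i) i

  limit-agrees : ∀ j {i} → i < size j → limit i ≡ F j i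
  limit-agrees j {i} i<s with ≤-total (suc i) j
  ... | inj₁ later = sym (stable* (≤⇒≤′ later) (size-grows i))
  ... | inj₂ earlier = stable* (≤⇒≤′ earlier) i<s

-- Doubling, the length of the j-th stage of the back-and-forth construction.
dbl : ℕ → ℕ
dbl zero    = zero
dbl (suc j) = suc (suc (dbl j))

dbl-mono : ∀ {j j'} → j ≤ j' → dbl j ≤ dbl j'
dbl-mono z≤n       = z≤n
dbl-mono (s≤s j≤j') = s≤s (s≤s (dbl-mono j≤j'))

n≤dbl : ∀ n → n ≤ dbl n
n≤dbl zero    = z≤n
n≤dbl (suc n) = s≤s (≤-trans (n≤dbl n) (n≤1+n _))

dbl-grows : ∀ n → n < dbl (suc n)
dbl-grows n = s≤s (≤-trans (n≤dbl n) (n≤1+n _))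

module Realization (L : Language) (𝑴 : Structure L)
                   (P : Pregeometry (Structure.Carrier 𝑴)) (wq : IsWQMPS L 𝑴 P) where
  open Structure 𝑴 renaming (Carrier to M)
  open Semantics L 𝑴
  open Pregeometry P
  open IsWQMPS wq
  open Syntax L 𝑴

  private
    ∅ : M → Set
    ∅ _ = ⊥

    nothing : ⊥ → M
    nothing ()

    nothing-enumerates : Enumerates nothing ∅
    nothing-enumerates = (λ ()) , (λ ()) , (λ _ ())

  realize-algebraic : ∀ {n} (t t' : Fin n → M) → SameType t t' → ∀ x → cl (image t) x →
                      ∃ λ x' → SameType [ t , const x ] [ t' , const {B = ⊤} x' ]
  realize-algebraic t t' st x x∈cl =
    let (x' , st') = QM5 ((λ ()) , (λ ())) ∅ ∅ nothing nothing nothing-enumerates nothing-enumerates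
                         (inj₂ (λ _ ())) (inj₂ (λ _ ())) (λ _ → ⇔-refl) t t'
                         (sameType-restrict st [ (λ ()) , id ] (λ { (inj₁ ()) ; (inj₂ _) → refl })
                                                               (λ { (inj₁ ()) ; (inj₂ _) → refl }))
                         x (monotone (image t) (∅ ∪ image t) (λ _ → inj₂) x x∈cl)
    in x' , sameType-restrict st' [ inj₁ ∘ inj₂ , inj₂ ]
              (λ { (inj₁ _) → refl ; (inj₂ _) → refl }) (λ { (inj₁ _) → refl ; (inj₂ _) → refl })

  closure-transfer : ∀ {n} {t t' : Fin n → M} {x x'} →
                     SameType [ t , const x ] [ t' , const {B = ⊤} x' ] → cl (image t) x → cl (image t') x'
  closure-transfer {t = t} {t'} {x} {x'} st =
    proj₁ (QM1 x x' t t' (sameType-restrict st swap (λ { (inj₁ _) → refl ; (inj₂ _) → refl })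
                                                    (λ { (inj₁ _) → refl ; (inj₂ _) → refl })))

  extend-agreement : ∀ {m} (b b' : Fin m → M) k {c c' : ℕ → M} →
                     AgreeOn (Below k) [ b , c ] [ b' , c' ] → ∀ x → cl (image b) x →
                     ∃ λ x' → cl (image b') x' ×
                              AgreeOn (Below (suc k)) [ b , c [ k ≔ x ] ] [ b' , c' [ k ≔ x' ] ]
  extend-agreement {m} b b' k {c} {c'} agree x x∈cl = x' , x'∈cl , agree'
    where
    prefix : Fin (m + k) → Fin m ⊎ ℕ
    prefix i = map₂ toℕ (splitAt m i)

    prefix-below : ∀ i → Below k (prefix i)
    prefix-below i with splitAt m i
    ... | inj₁ _ = tt
    ... | inj₂ j = toℕ<n j

    prefix-param : ∀ j → prefix (j ↑ˡ k) ≡ inj₁ j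
    prefix-param j = cong (map₂ toℕ) (splitAt-↑ˡ m j k)

    prefix-onto : Below k ⊆ Range prefix
    prefix-onto (inj₁ j) _   = j ↑ˡ k , prefix-param j
    prefix-onto (inj₂ i) i<k = m ↑ʳ fromℕ< i<k ,
      trans (cong (map₂ toℕ) (splitAt-↑ʳ m k (fromℕ< i<k))) (cong inj₂ (toℕ-fromℕ< i<k))

    t t' : Fin (m + k) → M
    t  = [ b , c ] ∘ prefix
    t' = [ b' , c' ] ∘ prefix

    realized : ∃ λ x' → SameType [ t , const x ] [ t' , const {B = ⊤} x' ]
    realized = realize-algebraic t t' (agree-restrict agree prefix prefix-below (λ _ → refl) (λ _ → refl)) x
                 (monotone (image b) (image t) (λ { _ (j , refl) → j ↑ˡ k , cong [ b , c ] (prefix-param j) }) x x∈cl)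

    x' : M
    x' = proj₁ realized

    x'∈cl : cl (image b') x'
    x'∈cl = closure-transfer (sameType-restrict (proj₂ realized) [ inj₁ ∘ (_↑ˡ k) , inj₂ ]
              (λ { (inj₁ j) → cong [ b , c ] (prefix-param j) ; (inj₂ _) → refl })
              (λ { (inj₁ j) → cong [ b' , c' ] (prefix-param j) ; (inj₂ _) → refl })) x∈cl

    extended : Fin (m + k) ⊎ ⊤ → Fin m ⊎ ℕ
    extended = [ prefix , const (inj₂ k) ]

    extended-onto : Below (suc k) ⊆ Range extended
    extended-onto (inj₁ j) _ = inj₁ (j ↑ˡ k) , prefix-param j
    extended-onto (inj₂ i) (s≤s i≤k) with m≤n⇒m<n∨m≡n i≤k
    ... | inj₁ i<k  = let (y , eq) = prefix-onto (inj₂ i) i<k in inj₁ y , eq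
    ... | inj₂ refl = inj₂ tt , refl

    agree' : AgreeOn (Below (suc k)) [ b , c [ k ≔ x ] ] [ b' , c' [ k ≔ x' ] ]
    agree' = agree-extend (proj₂ realized) extended
      (λ { (inj₁ i) → update-below c k x b (prefix i) (prefix-below i) ; (inj₂ _) → update-same c k x })
      (λ { (inj₁ i) → update-below c' k x' b' (prefix i) (prefix-below i) ; (inj₂ _) → update-same c' k x' })
      extended-onto

  -- Back-and-forth between cl(b) and cl(b'): starting from listings en, en' of
  -- the two closures, alternately match the next element of cl(b) and of
  -- cl(b').
  module BackAndForth {m} (b b' : Fin m → M) (st : SameType b b') {en en' : ℕ → M}
                      (en-lists : Lists en (cl (image b))) (en'-lists : Lists en' (cl (image b'))) where

    record Stage (k : ℕ) : Set where
      field
        c c'  : ℕ → M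
        agree : AgreeOn (Below k) [ b , c ] [ b' , c' ]
        c∈cl  : ∀ i → i < k → cl (image b) (c i)
        c'∈cl : ∀ i → i < k → cl (image b') (c' i)
    open Stage

    -- the empty stage (its sequences are never looked at)
    initial : Stage 0
    initial = record
      { c = en ; c' = en'
      ; agree = agree-extend st inj₁ (λ _ → refl) (λ _ → refl) (λ { (inj₁ j) _ → j , refl ; (inj₂ _) () })
      ; c∈cl = λ _ () ; c'∈cl = λ _ () }

    forth : ∀ {k} → Stage k → ∀ x → cl (image b) x → Stage (suc k)
    forth {k} s x x∈cl =
      let (x' , x'∈cl , agree') = extend-agreement b b' k (agree s) x x∈cl in
      record { c = c s [ k ≔ x ] ; c' = c' s [ k ≔ x' ] ; agree = agree'
             ; c∈cl = update-within (c s) k x {cl (image b)} (c∈cl s) x∈cl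
             ; c'∈cl = update-within (c' s) k x' {cl (image b')} (c'∈cl s) x'∈cl }

    back : ∀ {k} → Stage k → ∀ y → cl (image b') y → Stage (suc k)
    back {k} s y y∈cl =
      let (y' , y'∈cl , agree') = extend-agreement b' b k (AgreeOn-sym (agree s)) y y∈cl in
      record { c = c s [ k ≔ y' ] ; c' = c' s [ k ≔ y ] ; agree = AgreeOn-sym agree'
             ; c∈cl = update-within (c s) k y' {cl (image b)} (c∈cl s) y'∈cl
             ; c'∈cl = update-within (c' s) k y {cl (image b')} (c'∈cl s) y∈cl }

    -- round j places en j at position 2j and matches en' j at 2j + 1
    stage : ∀ j → Stage (dbl j)
    stage zero    = initial
    stage (suc j) = back (forth (stage j) (en j) (proj₁ en-lists j)) (en' j) (proj₁ en'-lists j)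

    -- each round only fills two new positions, so the stages stabilise
    module Left  = Stabilizing dbl dbl-mono dbl-grows (c ∘ stage)
                     (λ j → update-twice-below (c (stage j)) (en j) _)
    module Right = Stabilizing dbl dbl-mono dbl-grows (c' ∘ stage)
                     (λ j → update-twice-below (c' (stage j)) _ (en' j))

    abstract
      u u' : ℕ → M
      u  = Left.limit
      u' = Right.limit

      limit-near : ∀ (bb : Fin m → M) {F : ℕ → ℕ → M} {lim : ℕ → M} →
                   (∀ j {i} → i < dbl j → lim i ≡ F j i) →
                   ∀ N z → Below N z → [ bb , lim ]′ z ≡ [ bb , F N ]′ z
      limit-near bb agrees N (inj₁ _) _   = refl
      limit-near bb agrees N (inj₂ i) i<N = agrees N (<-≤-trans i<N (n≤dbl N))

      -- a formula mentions finitely many positions, all settled by some stage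
      sameType : SameType [ b , u ] [ b' , u' ]
      sameType φ =
        let (N , below) = finite-support φ in
        ⇔-trans (Sat-local _ _ φ (supported-mono (limit-near b Left.limit-agrees N) φ below))
        (⇔-trans (agree (stage N) φ (supported-mono (Below-mono (n≤dbl N)) φ below))
        (⇔-sym (Sat-local _ _ φ (supported-mono (limit-near b' Right.limit-agrees N) φ below))))

      u-lists : Lists u (cl (image b))
      u-lists = (λ i → c∈cl (stage (suc i)) i (dbl-grows i)) , λ x x∈cl →
        let (j , en-j≡x) = proj₂ en-lists x x∈cl in dbl j , trans (forth-step j) en-j≡x
        where
        forth-step : ∀ j → u (dbl j) ≡ en j
        forth-step j = trans (Left.limit-agrees (suc j) (s≤s (n≤1+n (dbl j))))
                             (trans (update-other (c (stage j) [ dbl j ≔ en j ]) (suc (dbl j)) _ (<⇒≢ ≤-refl))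
                                    (update-same (c (stage j)) (dbl j) (en j)))

      u'-lists : Lists u' (cl (image b'))
      u'-lists = (λ i → c'∈cl (stage (suc i)) i (dbl-grows i)) , λ x x∈cl →
        let (j , en'-j≡x) = proj₂ en'-lists x x∈cl in suc (dbl j) , trans (back-step j) en'-j≡x
        where
        back-step : ∀ j → u' (suc (dbl j)) ≡ en' j
        back-step j = trans (Right.limit-agrees (suc j) ≤-refl)
                            (update-same (c' (stage j) [ dbl j ≔ _ ]) (suc (dbl j)) (en' j))

module Dimension (em : ExcludedMiddle 0ℓ) (L : Language) (𝑴 : Structure L)
                 (P : Pregeometry (Structure.Carrier 𝑴)) (wq : IsWQMPS L 𝑴 P) where
  open import Data.List using (List; _∷ʳ_; length; map; lookup; allFin)
  open import Data.List.Properties using (length-++; length-map)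
  open import Data.List.Membership.Propositional using (_∈_)
  open import Data.List.Membership.Propositional.Properties using (∈-map⁺; ∈-map⁻; ∈-lookup; ∈-allFin)
  open import Data.List.Relation.Unary.Any using (index)
  open import Data.List.Relation.Unary.Any.Properties using (lookup-index)

  open Structure 𝑴 renaming (Carrier to M)
  open Semantics L 𝑴
  open Pregeometry P
  open Syntax L 𝑴
  open Realization L 𝑴 P wq using (closure-transfer)
  open PregeometryFacts em P

  private
    ∅ : M → Set
    ∅ _ = ⊥

  listed⊆image : ∀ {I : Set} (f : I → M) (l : List I) → (_∈ map f l) ⊆ image (f ∘ lookup l)
  listed⊆image f l x x∈ =
    let (j , j∈l , x≡fj) = ∈-map⁻ f x∈ in index j∈l , trans (cong f (sym (lookup-index j∈l))) (sym x≡fj)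

  image⊆listed : ∀ {I : Set} (f : I → M) (l : List I) → image (f ∘ lookup l) ⊆ (_∈ map f l)
  image⊆listed f l _ (i , refl) = ∈-map⁺ f (∈-lookup i)

  span-transfer : ∀ {m} {b b' : Fin m → M} → SameType b b' → ∀ l j →
                  cl (∅ ∪ (_∈ map b l)) (b j) → cl (∅ ∪ (_∈ map b' l)) (b' j)
  span-transfer {b = b} {b'} st l j bj∈ =
    monotone _ _ (λ x x∈ → inj₂ (image⊆listed b' l x x∈)) (b' j)
      (closure-transfer (sameType-restrict st [ lookup l , const j ]
                           (λ { (inj₁ _) → refl ; (inj₂ _) → refl }) (λ { (inj₁ _) → refl ; (inj₂ _) → refl }))
        (monotone _ _ (λ { _ (inj₁ ()) ; x (inj₂ x∈) → listed⊆image b l x x∈ }) (b j) bj∈))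

  -- If cl(b) is not everything, neither is cl(b') for b' of the same type:
  -- otherwise a basis of b extended by a point outside cl(b) would be an
  -- independent list inside cl(b'), longer than the matching basis of b'.
  outside-transfer : ∀ {m} (b b' : Fin m → M) → SameType b b' →
                     ∀ {a} → ¬ cl (image b) a → ∃ λ a' → ¬ cl (image b') a'
  outside-transfer {m} b b' st {a} a∉ = em⇒dne em λ none → 1+n≰n (too-long none)
    where
    l : List (Fin m)
    l = proj₁ (basis ∅ b (allFin m))

    l-independent : Independent ∅ (map b l)
    l-independent = proj₁ (proj₂ (basis ∅ b (allFin m)))

    l-spans : ∀ j → j ∈ allFin m → cl (∅ ∪ (_∈ map b l)) (b j)
    l-spans = proj₂ (proj₂ (basis ∅ b (allFin m)))

    b'-spanned : image b' ⊆ cl (∅ ∪ (_∈ map b' l))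
    b'-spanned _ (j , refl) = span-transfer st l j (l-spans j (∈-allFin j))

    a∉span : ¬ cl (∅ ∪ (_∈ map b l)) a
    a∉span a∈ = a∉ (monotone _ _ (λ { _ (inj₁ ()) ; x (inj₂ x∈) →
                                      let (j , _ , x≡bj) = ∈-map⁻ b x∈ in j , sym x≡bj }) a a∈)

    length-extended : length (map b l ∷ʳ a) ≡ suc (length l)
    length-extended = trans (length-++ (map b l)) (trans (+-comm _ 1) (cong suc (length-map b l)))

    too-long : ¬ (∃ λ a' → ¬ cl (image b') a') → suc (length l) ≤ length l
    too-long none = subst₂ _≤_ length-extended (length-map b' l)
      (steinitz ∅ (map b l ∷ʳ a) (map b' l)
        (independent-snoc ∅ (map b l) l-independent a∉span)
        (λ z _ → cl-least b'-spanned z (em⇒dne em λ z∉ → none (z , z∉))))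

module Extension (em : ExcludedMiddle 0ℓ) (L : Language) (𝑴 : Structure L)
                 (P : Pregeometry (Structure.Carrier 𝑴)) (wq : IsWQMPS L 𝑴 P) where
  open import Data.Vec.Functional using (_∷_)

  open Structure 𝑴 renaming (Carrier to M)
  open Semantics L 𝑴
  open Pregeometry P
  open IsWQMPS wq
  open Syntax L 𝑴
  open Realization L 𝑴 P wq
  open Dimension em L 𝑴 P wq using (outside-transfer)
  open Sequences em

  -- QM4 applied to the closures of b and b', enumerated compatibly by the
  -- back-and-forth: any point outside cl(b) has over b the type of any point
  -- outside cl(b') over b'.
  generic-extension : ∀ {m} (b b' : Fin (suc m) → M) → SameType b b' →
                      ∀ {a a'} → ¬ cl (image b) a → ¬ cl (image b') a' →
                      SameType [ b , const a ] [ b' , const {B = ⊤} a' ]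
  generic-extension {m} b b' st {a} {a'} a∉ a'∉ =
    sameType-restrict generic [ inj₁ ∘ position-of , inj₂ ]
      (λ { (inj₁ j) → at-b j ; (inj₂ _) → refl }) (λ { (inj₁ j) → at-b' j ; (inj₂ _) → refl })
    where
    entry∈cl : ∀ {n} (t : Fin n → M) j → cl (image t) (t j)
    entry∈cl t j = extensive (image t) (t j) (j , refl)

    open BackAndForth b b' st (proj₂ (countable-listed (QM3 b) (entry∈cl b zero)))
                              (proj₂ (countable-listed (QM3 b') (entry∈cl b' zero)))
    open Deduplicate u

    enum : Enumerates (u ∘ index) (cl (image b))
    enum = enumerates u (λ _ _ → ⇔-refl) u-lists

    enum' : Enumerates (u' ∘ index) (cl (image b'))
    enum' = enumerates u' (λ i j → sameType-≡ sameType (inj₂ i) (inj₂ j)) u'-lists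

    generic : SameType [ u ∘ index , const a ] [ u' ∘ index , const {B = ⊤} a' ]
    generic = QM4 countable (cl (image b)) (cl (image b')) _ _ enum enum'
                  (idempotent (image b)) (idempotent (image b'))
                  (sameType-restrict sameType (inj₂ ∘ index) (λ _ → refl) (λ _ → refl)) a a' a∉ a'∉

    -- where u lists the entry b j; u' lists b' j at the same place
    position-of : Fin (suc m) → Position
    position-of j = proj₁ (proj₂ (proj₂ enum) (b j) (entry∈cl b j))

    at-b : ∀ j → u (index (position-of j)) ≡ b j
    at-b j = proj₂ (proj₂ (proj₂ enum) (b j) (entry∈cl b j))

    at-b' : ∀ j → u' (index (position-of j)) ≡ b' j
    at-b' j = proj₁ (sameType-≡ sameType (inj₂ (index (position-of j))) (inj₁ j)) (at-b j)

  extend-one : ∀ {m} (b b' : Fin m → M) → SameType b b' →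
               ∀ a → ∃ λ a' → SameType [ b , const a ] [ b' , const {B = ⊤} a' ]
  extend-one {zero} b b' st a =
    a , sameType-restrict {v = [ b , const a ]} (λ _ → ⇔-refl) id
          (λ _ → refl) (λ { (inj₁ ()) ; (inj₂ _) → refl })
  extend-one {suc m} b b' st a with em {cl (image b) a}
  ... | yes a∈ = realize-algebraic b b' st a a∈
  ... | no  a∉ = let (a' , a'∉) = outside-transfer b b' st a∉ in a' , generic-extension b b' st a∉ a'∉

  extend-front : ∀ {n m} (a : Fin (suc n) → M) (r : Fin n → M) (b b' : Fin m → M) →
                 SameType [ a ∘ suc , b ] [ r , b' ] → ∃ λ x → SameType [ a , b ] [ x ∷ r , b' ]
  extend-front {n} {m} a r b b' st = proj₁ extended , sameType-restrict (proj₂ extended) unflatten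
    (λ { (inj₁ zero) → refl ; (inj₁ (suc i)) → cong [ a ∘ suc , b ] (splitAt-↑ˡ n i m)
       ; (inj₂ j) → cong [ a ∘ suc , b ] (splitAt-↑ʳ n m j) })
    (λ { (inj₁ zero) → refl ; (inj₁ (suc i)) → cong [ r , b' ] (splitAt-↑ˡ n i m)
       ; (inj₂ j) → cong [ r , b' ] (splitAt-↑ʳ n m j) })
    where
    flat flat' : Fin (n + m) → M
    flat  = [ a ∘ suc , b ] ∘ splitAt n
    flat' = [ r , b' ] ∘ splitAt n

    extended : ∃ λ x → SameType [ flat , const (a zero) ] [ flat' , const {B = ⊤} x ]
    extended = extend-one flat flat' (sameType-restrict st (splitAt n) (λ _ → refl) (λ _ → refl)) (a zero)

    unflatten : Fin (suc n) ⊎ Fin m → Fin (n + m) ⊎ ⊤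
    unflatten (inj₁ zero)    = inj₂ tt
    unflatten (inj₁ (suc i)) = inj₁ (i ↑ˡ m)
    unflatten (inj₂ j)       = inj₁ (n ↑ʳ j)

lemma2p1 : ExcludedMiddle 0ℓ →
    (L : Language) (𝑴 : Structure L) (P : Pregeometry (Structure.Carrier 𝑴)) →
    IsWQMPS L 𝑴 P →
    (n m : ℕ) (b b' : Fin m → Structure.Carrier 𝑴) →
    Semantics.SameType L 𝑴 b b' →
    (a : Fin n → Structure.Carrier 𝑴) →
    ∃ λ (a' : Fin n → Structure.Carrier 𝑴) → Semantics.SameType L 𝑴 [ a , b ] [ a' , b' ]
lemma2p1 em L 𝑴 P wq zero m b b' st a =
  a , Syntax.sameType-restrict L 𝑴 st [ (λ ()) , id ]
        (λ { (inj₁ ()) ; (inj₂ _) → refl }) (λ { (inj₁ ()) ; (inj₂ _) → refl })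
lemma2p1 em L 𝑴 P wq (suc n) m b b' st a =
  let (r , st-r) = lemma2p1 em L 𝑴 P wq n m b b' st (a ∘ suc)
      (x , st-x) = Extension.extend-front em L 𝑴 P wq a r b b' st-r
  in x ∷ r , st-x
  where open import Data.Vec.Functional using (_∷_)
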